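{- Let $a,b,e\in\mathbb Z$ with $a\neq 0$ and $e>0$, and let $h_2(j)=aj^2+bj+e$ for $j\in\mathbb Z_{\geq 0}$, where it is assumed that $h_2(j)\geq 0$ for all $j\geq 0$. Put $\alpha=a/e$, $\beta=b/e$ and $f(x)=\frac{1}{2}x^2-(\alpha+\beta+\frac{3}{2})x+(5\alpha+3\beta+2)$. Assume $\alpha+\beta\geq 2$. If there exists an integer $d$ with $3\leq d\leq c(h_2)+1$ such that $f(d)<0$, then $\operatorname{hdepth}(h_2)<d$.
   Context: $\mathcal H_0$ denotes the set of functions $h:\mathbb Z_{\geq 0}\to\mathbb Z_{\geq 0}$ with $h(0)>0$. For $h\in\mathcal H_0$ and integers $0\leq k\leq d$, set $\beta_k^d(h)=\sum_{j=0}^k(-1)^{k-j}\binom{d-j}{k-j}h(j)$. The Hilbert depth of $h$ is $\operatorname{hdepth}(h)=\max\{d\in\mathbb Z_{\geq 0}\;:\;\beta_k^d(h)\geq 0\text{ for all }0\leq k\leq d\}$. Also $c(h):=\lfloor h(1)/h(0)\rfloor$. -}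

module Defs where

open import Data.Nat using (ℕ; zero; suc; _∸_; _≤_) renaming (_+_ to _+ℕ_)
open import Data.Nat.DivMod using (_/_)
open import Data.Nat.Combinatorics using (_C_)
open import Data.Integer using (ℤ; +_; -_) renaming (_+_ to _+ℤ_; _*_ to _*ℤ_; _≤_ to _≤ℤ_)
open import Data.Rational as ℚ using (ℚ; _+_; _-_; _*_; 1ℚ; 0ℚ)

sgn : ℕ → ℤ
sgn zero = + 1
sgn (suc n) = - sgn n

betaTerm : (k d : ℕ) → (ℕ → ℕ) → ℕ → ℤ
betaTerm k d h j = sgn (k ∸ j) *ℤ (+ ((d ∸ j) C (k ∸ j))) *ℤ (+ h j)

betaSum : (k d : ℕ) → (ℕ → ℕ) → ℕ → ℤ
betaSum k d h zero = + 0
betaSum k d h (suc m) = betaSum k d h m +ℤ betaTerm k d h m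

beta : (k d : ℕ) → (ℕ → ℕ) → ℤ
beta k d h = betaSum k d h (suc k)

-- d is admissible for h: β_k^d(h) ≥ 0 for all 0 ≤ k ≤ d.
-- hdepth(h) is the maximum admissible d.
HdepthAdmissible : (ℕ → ℕ) → ℕ → Set
HdepthAdmissible h d = ∀ k → k ≤ d → + 0 ≤ℤ beta k d h

-- c(h) = ⌊h(1)/h(0)⌋ (h(0) > 0 for h ∈ H₀; value 0 otherwise, irrelevant)
cH : (ℕ → ℕ) → ℕ
cH h with h 0
... | zero = 0
... | suc m = h 1 / suc m

h2 : ℤ → ℤ → ℤ → ℕ → ℤ
h2 a b e j = a *ℤ (+ j) *ℤ (+ j) +ℤ b *ℤ (+ j) +ℤ e

fpoly : ℚ → ℚ → ℚ → ℚ
fpoly α β x =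
  (+ 1 ℚ./ 2) * x * x - (α + β + (+ 3 ℚ./ 2)) * x
  + ((+ 5 ℚ./ 1) * α + (+ 3 ℚ./ 1) * β + (+ 2 ℚ./ 1))

{-# OPTIONS --safe #-}
-- For h = h₂ one computes β₁ᵈ(h) = a + b + e − de and 2β₂ᵈ(h) = 2e·f(d) =: G(d), an integer.
-- If some D ≥ d were admissible, then β₁ᴰ ≥ 0 makes G non-increasing on [d, D], because
-- G(d) − G(D) = (D − d)(2β₁ᴰ + (D − d + 1)e); hence 2e·f(d) = G(d) ≥ G(D) = 2β₂ᴰ ≥ 0, contradicting
-- f(d) < 0. Only β₁ᴰ and β₂ᴰ enter.
module Submission where

open import Data.Nat as ℕ using (ℕ; zero; suc; NonZero; z≤n; s≤s)
import Data.Nat.Properties as ℕₚ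
open import Data.Nat.Combinatorics using (_C_; nC1≡n; nCk+nC[k+1]≡[n+1]C[k+1])
open import Data.Integer as ℤ using (ℤ; +_; 0ℤ)
import Data.Integer.Properties as ℤₚ
open import Data.Integer.Tactic.RingSolver using (solve-∀)
open import Data.Rational as ℚ using (ℚ; _/_; 0ℚ; toℚᵘ)
import Data.Rational.Properties as ℚₚ
open import Data.Rational.Unnormalised as ℚᵘ using (mkℚᵘ; *≡*; _≃_)
import Data.Rational.Unnormalised.Properties as ℚᵘₚ
open import Relation.Binary.PropositionalEquality
open import Relation.Nullary.Decidable using (dec⇒maybe)
open import Level using (0ℓ)
import Tactic.RingSolver as RingSolver
open import Tactic.RingSolver.Core.AlmostCommutativeRing using (AlmostCommutativeRing; fromCommutativeRing)
open import Defs

module _ where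
  open import Data.Nat using (_+_; _*_)
  open ≡-Reasoning

  2*[1+n]C2≡[1+n]*n : ∀ n → 2 * (suc n C 2) ≡ suc n * n
  2*[1+n]C2≡[1+n]*n zero    = refl
  2*[1+n]C2≡[1+n]*n (suc n) = begin
    2 * (suc (suc n) C 2)          ≡⟨ cong (2 *_) (nCk+nC[k+1]≡[n+1]C[k+1] (suc n) 1) ⟨
    2 * (suc n C 1 + suc n C 2)    ≡⟨ cong (λ c → 2 * (c + suc n C 2)) (nC1≡n (suc n)) ⟩
    2 * (suc n + suc n C 2)        ≡⟨ ℕₚ.*-distribˡ-+ 2 (suc n) (suc n C 2) ⟩
    2 * suc n + 2 * (suc n C 2)    ≡⟨ cong (_+_ (2 * suc n)) (2*[1+n]C2≡[1+n]*n n) ⟩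
    2 * suc n + suc n * n          ≡⟨ cong (_+_ (2 * suc n)) (ℕₚ.*-comm (suc n) n) ⟩
    2 * suc n + n * suc n          ≡⟨ ℕₚ.*-distribʳ-+ (suc n) 2 n ⟨
    suc (suc n) * suc n            ∎

module _ where
  open import Data.Integer using (-_; _+_; _*_; _-_; _≤_)

  beta-1-expand : ∀ d h → beta 1 d h ≡ + h 1 - + d * + h 0
  beta-1-expand d h = begin
    + 0 + - + 1 * + (d C 1) * + h 0 + + 1 * + 1 * + h 1
      ≡⟨ cong (λ c → + 0 + - + 1 * + c * + h 0 + + 1 * + 1 * + h 1) (nC1≡n d) ⟩
    + 0 + - + 1 * + d * + h 0 + + 1 * + 1 * + h 1
      ≡⟨ identity (+ d) (+ h 0) (+ h 1) ⟩
    + h 1 - + d * + h 0 ∎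
    where
    open ≡-Reasoning
    identity : ∀ d h₀ h₁ → + 0 + - + 1 * d * h₀ + + 1 * + 1 * h₁ ≡ h₁ - d * h₀
    identity = solve-∀

  beta-2-expand : ∀ n h →
    + 2 * beta 2 (suc n) h ≡ + suc n * + n * + h 0 - + 2 * + n * + h 1 + + 2 * + h 2
  beta-2-expand n h = begin
    + 2 * (+ 0 + + 1 * + (suc n C 2) * + h 0 + - + 1 * + (n C 1) * + h 1 + + 1 * + 1 * + h 2)
      ≡⟨ cong (λ c → + 2 * (+ 0 + + 1 * + (suc n C 2) * + h 0 + - + 1 * + c * + h 1 + + 1 * + 1 * + h 2))
              (nC1≡n n) ⟩
    + 2 * (+ 0 + + 1 * + (suc n C 2) * + h 0 + - + 1 * + n * + h 1 + + 1 * + 1 * + h 2)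
      ≡⟨ identity (+ (suc n C 2)) (+ n) (+ h 0) (+ h 1) (+ h 2) ⟩
    + 2 * + (suc n C 2) * + h 0 - + 2 * + n * + h 1 + + 2 * + h 2
      ≡⟨ cong (λ c → c * + h 0 - + 2 * + n * + h 1 + + 2 * + h 2) twice-C2 ⟩
    + suc n * + n * + h 0 - + 2 * + n * + h 1 + + 2 * + h 2 ∎
    where
    open ≡-Reasoning
    identity : ∀ c n h₀ h₁ h₂ →
      + 2 * (+ 0 + + 1 * c * h₀ + - + 1 * n * h₁ + + 1 * + 1 * h₂) ≡ + 2 * c * h₀ - + 2 * n * h₁ + + 2 * h₂
    identity = solve-∀
    twice-C2 : + 2 * + (suc n C 2) ≡ + suc n * + n
    twice-C2 = begin
      + 2 * + (suc n C 2)       ≡⟨ ℤₚ.pos-* 2 (suc n C 2) ⟨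
      + (2 ℕ.* (suc n C 2))     ≡⟨ cong +_ (2*[1+n]C2≡[1+n]*n n) ⟩
      + (suc n ℕ.* n)           ≡⟨ ℤₚ.pos-* (suc n) n ⟩
      + suc n * + n             ∎

  -- 2e · f(x) for α = a/e and β = b/e
  scaledF : ℤ → ℤ → ℤ → ℤ → ℤ
  scaledF a b e x = e * x * x - (+ 2 * a + + 2 * b + + 3 * e) * x + (+ 10 * a + + 6 * b + + 4 * e)

  0≤i*j : ∀ {i j} → 0ℤ ≤ i → 0ℤ ≤ j → 0ℤ ≤ i * j
  0≤i*j {i} {j} 0≤i 0≤j =
    subst (_≤ i * j) (ℤₚ.*-zeroʳ i) (ℤₚ.*-monoˡ-≤-nonNeg i {{ℤ.nonNegative 0≤i}} 0≤j)

  scaledF-antitone : ∀ a b e {x y} → 0ℤ ≤ e → x ≤ y → 0ℤ ≤ a + b + e - y * e →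
                     scaledF a b e y ≤ scaledF a b e x
  scaledF-antitone a b e {x} {y} 0≤e x≤y 0≤β₁ = begin
    scaledF a b e y                       ≤⟨ ℤₚ.i≤i+j _ _ {{ℤ.nonNegative 0≤growth}} ⟩
    scaledF a b e y + (y - x) * slope     ≡⟨ identity a b e x y ⟨
    scaledF a b e x                       ∎
    where
    open ℤₚ.≤-Reasoning
    slope = + 2 * (a + b + e - y * e) + (y - x + + 1) * e
    0≤growth : 0ℤ ≤ (y - x) * slope
    0≤growth = 0≤i*j (ℤₚ.i≤j⇒0≤j-i x≤y)
      (ℤₚ.+-mono-≤ (0≤i*j {+ 2} (ℤ.+≤+ z≤n) 0≤β₁) (0≤i*j (ℤₚ.+-mono-≤ (ℤₚ.i≤j⇒0≤j-i x≤y) (ℤ.+≤+ z≤n)) 0≤e))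
    -- The ring solver does not unfold definitions, so its identities are stated on unfolded terms.
    identity : ∀ a b e x y →
      e * x * x - (+ 2 * a + + 2 * b + + 3 * e) * x + (+ 10 * a + + 6 * b + + 4 * e)
      ≡ e * y * y - (+ 2 * a + + 2 * b + + 3 * e) * y + (+ 10 * a + + 6 * b + + 4 * e)
        + (y - x) * (+ 2 * (a + b + e - y * e) + (y - x + + 1) * e)
    identity = solve-∀

  module _ (a b e : ℤ) {h : ℕ → ℕ} (h≡h₂ : ∀ j → + h j ≡ h2 a b e j) where

    beta-1-h2 : ∀ d → beta 1 d h ≡ a + b + e - + d * e
    beta-1-h2 d = begin
      beta 1 d h                     ≡⟨ beta-1-expand d h ⟩
      + h 1 - + d * + h 0            ≡⟨ cong₂ (λ h₁ h₀ → h₁ - + d * h₀) (h≡h₂ 1) (h≡h₂ 0) ⟩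
      h2 a b e 1 - + d * h2 a b e 0  ≡⟨ identity a b e (+ d) ⟩
      a + b + e - + d * e            ∎
      where
      open ≡-Reasoning
      identity : ∀ a b e d →
        a * + 1 * + 1 + b * + 1 + e - d * (a * + 0 * + 0 + b * + 0 + e) ≡ a + b + e - d * e
      identity = solve-∀

    beta-2-h2 : ∀ n → + 2 * beta 2 (suc n) h ≡ scaledF a b e (+ suc n)
    beta-2-h2 n = begin
      + 2 * beta 2 (suc n) h
        ≡⟨ beta-2-expand n h ⟩
      + suc n * + n * + h 0 - + 2 * + n * + h 1 + + 2 * + h 2
        ≡⟨ cong₂ (λ h₀ h₁ → + suc n * + n * h₀ - + 2 * + n * h₁ + + 2 * + h 2) (h≡h₂ 0) (h≡h₂ 1) ⟩
      + suc n * + n * h2 a b e 0 - + 2 * + n * h2 a b e 1 + + 2 * + h 2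
        ≡⟨ cong (λ h₂ → + suc n * + n * h2 a b e 0 - + 2 * + n * h2 a b e 1 + + 2 * h₂) (h≡h₂ 2) ⟩
      + suc n * + n * h2 a b e 0 - + 2 * + n * h2 a b e 1 + + 2 * h2 a b e 2
        ≡⟨ identity a b e (+ n) ⟩
      scaledF a b e (+ suc n) ∎
      where
      open ≡-Reasoning
      identity : ∀ a b e n →
        (+ 1 + n) * n * (a * + 0 * + 0 + b * + 0 + e) - + 2 * n * (a * + 1 * + 1 + b * + 1 + e)
          + + 2 * (a * + 2 * + 2 + b * + 2 + e)
        ≡ e * (+ 1 + n) * (+ 1 + n) - (+ 2 * a + + 2 * b + + 3 * e) * (+ 1 + n)
          + (+ 10 * a + + 6 * b + + 4 * e)
      identity = solve-∀

  admissible⇒0≤scaledF : ∀ a b e {h D d} → (∀ j → + h j ≡ h2 a b (+ e) j) →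
    HdepthAdmissible h D → 2 ℕ.≤ D → d ℕ.≤ D → 0ℤ ≤ scaledF a b (+ e) (+ d)
  admissible⇒0≤scaledF a b e {h} {D@(suc (suc n))} {d} h≡h₂ admissible (s≤s (s≤s _)) d≤D = begin
    0ℤ                        ≤⟨ 0≤i*j {+ 2} (ℤ.+≤+ z≤n) (admissible 2 (s≤s (s≤s z≤n))) ⟩
    + 2 * beta 2 D h          ≡⟨ beta-2-h2 a b (+ e) h≡h₂ (suc n) ⟩
    scaledF a b (+ e) (+ D)   ≤⟨ scaledF-antitone a b (+ e) (ℤ.+≤+ z≤n) (ℤ.+≤+ d≤D) 0≤β₁ ⟩
    scaledF a b (+ e) (+ d)   ∎
    where
    open ℤₚ.≤-Reasoning
    0≤β₁ : 0ℤ ≤ a + b + + e - + D * + e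
    0≤β₁ = subst (0ℤ ≤_) (beta-1-h2 a b (+ e) h≡h₂ D) (admissible 1 (s≤s z≤n))

module _ where
  open import Data.Rational using (_+_; _*_; _-_; -_; _<_)

  fromℤ : ℤ → ℚ
  fromℤ i = i / 1

  toℚᵘ-/ : ∀ i n .{{_ : NonZero n}} → toℚᵘ (i / n) ≃ i ℚᵘ./ n
  toℚᵘ-/ i (suc m) = ℚₚ.toℚᵘ-fromℚᵘ (mkℚᵘ i m)

  fromℤ-homo-+ : ∀ i j → fromℤ (i ℤ.+ j) ≡ fromℤ i + fromℤ j
  fromℤ-homo-+ i j = ℚₚ.toℚᵘ-injective (begin
    toℚᵘ (fromℤ (i ℤ.+ j))              ≈⟨ toℚᵘ-/ (i ℤ.+ j) 1 ⟩
    mkℚᵘ (i ℤ.+ j) 0                    ≈⟨ *≡* (identity i j) ⟩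
    mkℚᵘ i 0 ℚᵘ.+ mkℚᵘ j 0              ≈⟨ ℚᵘₚ.+-cong (toℚᵘ-/ i 1) (toℚᵘ-/ j 1) ⟨
    toℚᵘ (fromℤ i) ℚᵘ.+ toℚᵘ (fromℤ j)  ≈⟨ ℚₚ.toℚᵘ-homo-+ (fromℤ i) (fromℤ j) ⟨
    toℚᵘ (fromℤ i + fromℤ j)            ∎)
    where
    open ℚᵘₚ.≃-Reasoning
    identity : ∀ i j → (i ℤ.+ j) ℤ.* + 1 ≡ (i ℤ.* + 1 ℤ.+ j ℤ.* + 1) ℤ.* + 1
    identity = solve-∀

  fromℤ-homo-* : ∀ i j → fromℤ (i ℤ.* j) ≡ fromℤ i * fromℤ j
  fromℤ-homo-* i j = ℚₚ.toℚᵘ-injective (begin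
    toℚᵘ (fromℤ (i ℤ.* j))              ≈⟨ toℚᵘ-/ (i ℤ.* j) 1 ⟩
    mkℚᵘ i 0 ℚᵘ.* mkℚᵘ j 0              ≈⟨ ℚᵘₚ.*-cong (toℚᵘ-/ i 1) (toℚᵘ-/ j 1) ⟨
    toℚᵘ (fromℤ i) ℚᵘ.* toℚᵘ (fromℤ j)  ≈⟨ ℚₚ.toℚᵘ-homo-* (fromℤ i) (fromℤ j) ⟨
    toℚᵘ (fromℤ i * fromℤ j)            ∎)
    where open ℚᵘₚ.≃-Reasoning

  fromℤ-homo‿- : ∀ i → fromℤ (ℤ.- i) ≡ - fromℤ i
  fromℤ-homo‿- i = ℚₚ.toℚᵘ-injective (begin
    toℚᵘ (fromℤ (ℤ.- i))   ≈⟨ toℚᵘ-/ (ℤ.- i) 1 ⟩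
    ℚᵘ.- mkℚᵘ i 0          ≈⟨ ℚᵘₚ.-‿cong (toℚᵘ-/ i 1) ⟨
    ℚᵘ.- toℚᵘ (fromℤ i)    ≈⟨ ℚₚ.toℚᵘ-homo‿- (fromℤ i) ⟨
    toℚᵘ (- fromℤ i)       ∎)
    where open ℚᵘₚ.≃-Reasoning

  fromℤ-cancel-< : ∀ {i j} → fromℤ i < fromℤ j → i ℤ.< j
  fromℤ-cancel-< {i} {j} i<j = subst₂ ℤ._<_ (ℤₚ.*-identityʳ i) (ℤₚ.*-identityʳ j) (ℚᵘₚ.drop-*<*
    (ℚᵘₚ.<-respˡ-≃ (toℚᵘ-/ i 1) (ℚᵘₚ.<-respʳ-≃ (toℚᵘ-/ j 1) (ℚₚ.toℚᵘ-mono-< i<j))))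

  i/n*n≡i : ∀ i n .{{_ : NonZero n}} → (i / n) * fromℤ (+ n) ≡ fromℤ i
  i/n*n≡i i n@(suc m) = ℚₚ.toℚᵘ-injective (begin
    toℚᵘ ((i / n) * fromℤ (+ n))              ≈⟨ ℚₚ.toℚᵘ-homo-* (i / n) (fromℤ (+ n)) ⟩
    toℚᵘ (i / n) ℚᵘ.* toℚᵘ (fromℤ (+ n))      ≈⟨ ℚᵘₚ.*-cong (toℚᵘ-/ i n) (toℚᵘ-/ (+ n) 1) ⟩
    mkℚᵘ i m ℚᵘ.* mkℚᵘ (+ n) 0                ≈⟨ *≡* cross-multiplied ⟩
    mkℚᵘ i 0                                  ≈⟨ toℚᵘ-/ i 1 ⟨
    toℚᵘ (fromℤ i)                            ∎)
    where
    open ℚᵘₚ.≃-Reasoning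
    cross-multiplied : i ℤ.* + n ℤ.* + 1 ≡ i ℤ.* + (n ℕ.* 1)
    cross-multiplied = trans (ℤₚ.*-identityʳ (i ℤ.* + n)) (cong (λ k → i ℤ.* + k) (sym (ℕₚ.*-identityʳ n)))

  fromℤ-linear : ∀ p a q b r c → fromℤ (p ℤ.* a ℤ.+ q ℤ.* b ℤ.+ r ℤ.* c)
                 ≡ fromℤ p * fromℤ a + fromℤ q * fromℤ b + fromℤ r * fromℤ c
  fromℤ-linear p a q b r c = begin
    fromℤ (p ℤ.* a ℤ.+ q ℤ.* b ℤ.+ r ℤ.* c)
      ≡⟨ fromℤ-homo-+ (p ℤ.* a ℤ.+ q ℤ.* b) (r ℤ.* c) ⟩
    fromℤ (p ℤ.* a ℤ.+ q ℤ.* b) + fromℤ (r ℤ.* c)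
      ≡⟨ cong₂ _+_ (fromℤ-homo-+ (p ℤ.* a) (q ℤ.* b)) (fromℤ-homo-* r c) ⟩
    fromℤ (p ℤ.* a) + fromℤ (q ℤ.* b) + fromℤ r * fromℤ c
      ≡⟨ cong₂ (λ u v → u + v + fromℤ r * fromℤ c) (fromℤ-homo-* p a) (fromℤ-homo-* q b) ⟩
    fromℤ p * fromℤ a + fromℤ q * fromℤ b + fromℤ r * fromℤ c ∎
    where open ≡-Reasoning

  fromℤ-scaledF : ∀ a b e x → let A = fromℤ a; B = fromℤ b; E = fromℤ e; X = fromℤ x in
    fromℤ (scaledF a b e x)
    ≡ E * X * X - (fromℤ (+ 2) * A + fromℤ (+ 2) * B + fromℤ (+ 3) * E) * X
      + (fromℤ (+ 10) * A + fromℤ (+ 6) * B + fromℤ (+ 4) * E)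
  fromℤ-scaledF a b e x = begin
    fromℤ (e ℤ.* x ℤ.* x ℤ.- s ℤ.* x ℤ.+ t)
      ≡⟨ fromℤ-homo-+ (e ℤ.* x ℤ.* x ℤ.- s ℤ.* x) t ⟩
    fromℤ (e ℤ.* x ℤ.* x ℤ.- s ℤ.* x) + fromℤ t
      ≡⟨ cong (_+ fromℤ t) (fromℤ-homo-+ (e ℤ.* x ℤ.* x) (ℤ.- (s ℤ.* x))) ⟩
    fromℤ (e ℤ.* x ℤ.* x) + fromℤ (ℤ.- (s ℤ.* x)) + fromℤ t
      ≡⟨ cong (λ v → fromℤ (e ℤ.* x ℤ.* x) + v + fromℤ t) (fromℤ-homo‿- (s ℤ.* x)) ⟩
    fromℤ (e ℤ.* x ℤ.* x) - fromℤ (s ℤ.* x) + fromℤ t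
      ≡⟨ cong₂ (λ u v → u - v + fromℤ t) fromℤ-exx (fromℤ-homo-* s x) ⟩
    E * X * X - fromℤ s * X + fromℤ t
      ≡⟨ cong₂ (λ u v → E * X * X - u * X + v)
               (fromℤ-linear (+ 2) a (+ 2) b (+ 3) e) (fromℤ-linear (+ 10) a (+ 6) b (+ 4) e) ⟩
    E * X * X - (fromℤ (+ 2) * A + fromℤ (+ 2) * B + fromℤ (+ 3) * E) * X
      + (fromℤ (+ 10) * A + fromℤ (+ 6) * B + fromℤ (+ 4) * E) ∎
    where
    open ≡-Reasoning
    A = fromℤ a
    B = fromℤ b
    E = fromℤ e
    X = fromℤ x
    s = + 2 ℤ.* a ℤ.+ + 2 ℤ.* b ℤ.+ + 3 ℤ.* e
    t = + 10 ℤ.* a ℤ.+ + 6 ℤ.* b ℤ.+ + 4 ℤ.* e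
    fromℤ-exx : fromℤ (e ℤ.* x ℤ.* x) ≡ E * X * X
    fromℤ-exx = trans (fromℤ-homo-* (e ℤ.* x) x) (cong (_* X) (fromℤ-homo-* e x))

  ℚ-ring : AlmostCommutativeRing 0ℓ 0ℓ
  ℚ-ring = fromCommutativeRing ℚₚ.+-*-commutativeRing (λ p → dec⇒maybe (0ℚ ℚₚ.≟ p))

  fpoly*2E-expand : ∀ α β E X → fpoly α β X * (fromℤ (+ 2) * E)
    ≡ E * X * X - (fromℤ (+ 2) * (α * E) + fromℤ (+ 2) * (β * E) + fromℤ (+ 3) * E) * X
      + (fromℤ (+ 10) * (α * E) + fromℤ (+ 6) * (β * E) + fromℤ (+ 4) * E)
  fpoly*2E-expand = identity
    where
    identity : ∀ α β E X →
      ((+ 1 / 2) * X * X - (α + β + (+ 3 / 2)) * X + ((+ 5 / 1) * α + (+ 3 / 1) * β + (+ 2 / 1)))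
        * (fromℤ (+ 2) * E)
      ≡ E * X * X - (fromℤ (+ 2) * (α * E) + fromℤ (+ 2) * (β * E) + fromℤ (+ 3) * E) * X
        + (fromℤ (+ 10) * (α * E) + fromℤ (+ 6) * (β * E) + fromℤ (+ 4) * E)
    identity = RingSolver.solve-∀ ℚ-ring

  fpoly*2e≡scaledF : ∀ a b e .{{_ : NonZero e}} x →
    fpoly (a / e) (b / e) (fromℤ x) * (fromℤ (+ 2) * fromℤ (+ e)) ≡ fromℤ (scaledF a b (+ e) x)
  fpoly*2e≡scaledF a b e x = begin
    fpoly (a / e) (b / e) X * (fromℤ (+ 2) * E)
      ≡⟨ fpoly*2E-expand (a / e) (b / e) E X ⟩
    E * X * X - (fromℤ (+ 2) * ((a / e) * E) + fromℤ (+ 2) * ((b / e) * E) + fromℤ (+ 3) * E) * X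
      + (fromℤ (+ 10) * ((a / e) * E) + fromℤ (+ 6) * ((b / e) * E) + fromℤ (+ 4) * E)
      ≡⟨ cong₂ (λ A B → E * X * X - (fromℤ (+ 2) * A + fromℤ (+ 2) * B + fromℤ (+ 3) * E) * X
                          + (fromℤ (+ 10) * A + fromℤ (+ 6) * B + fromℤ (+ 4) * E))
               (i/n*n≡i a e) (i/n*n≡i b e) ⟩
    E * X * X - (fromℤ (+ 2) * fromℤ a + fromℤ (+ 2) * fromℤ b + fromℤ (+ 3) * E) * X
      + (fromℤ (+ 10) * fromℤ a + fromℤ (+ 6) * fromℤ b + fromℤ (+ 4) * E)
      ≡⟨ fromℤ-scaledF a b (+ e) x ⟨
    fromℤ (scaledF a b (+ e) x) ∎
    where
    open ≡-Reasoning
    E = fromℤ (+ e)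
    X = fromℤ x

  fpoly<0⇒scaledF<0 : ∀ a b e .{{_ : NonZero e}} x →
    fpoly (a / e) (b / e) (fromℤ x) < 0ℚ → scaledF a b (+ e) x ℤ.< 0ℤ
  fpoly<0⇒scaledF<0 a b e x f<0 = fromℤ-cancel-< (subst₂ _<_
    (fpoly*2e≡scaledF a b e x) (ℚₚ.*-zeroˡ 2e) (ℚₚ.*-monoˡ-<-pos 2e {{2e-pos}} f<0))
    where
    2e = fromℤ (+ 2) * fromℤ (+ e)
    2e-pos : ℚ.Positive 2e
    2e-pos = ℚₚ.pos*pos⇒pos (fromℤ (+ 2)) (fromℤ (+ e)) {{ℚₚ.normalize-pos e 1}}

open import Data.Nat using (_≤_; _<_) renaming (_+_ to _+ℕ_)
open import Data.Rational using (_+_)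

lemma2p3 : (a b : ℤ) (e : ℕ) .{{_ : NonZero e}} → a ≢ 0ℤ →
    (h : ℕ → ℕ) → (∀ j → + h j ≡ h2 a b (+ e) j) →
    (+ 2 / 1) ℚ.≤ (a / e) + (b / e) →
    (d : ℕ) → 3 ≤ d → d ≤ cH h +ℕ 1 →
    fpoly (a / e) (b / e) (+ d / 1) ℚ.< 0ℚ →
    ∀ d′ → HdepthAdmissible h d′ → d′ < d
lemma2p3 a b e _ h h≡h₂ _ d 3≤d _ f<0 d′ admissible = ℕₚ.≰⇒> λ d≤d′ →
  ℤₚ.<⇒≱ (fpoly<0⇒scaledF<0 a b e (+ d) f<0)
         (admissible⇒0≤scaledF a b e h≡h₂ admissible (ℕₚ.≤-trans (ℕₚ.<⇒≤ 3≤d) d≤d′) d≤d′)
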